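{- Let $G=(V,E)$ be a directed graph and $G_h=(V_h,E_h)$ a subgraph of $G$. Let $W_h\subseteq V_h$ be a set of white vertices such that every $u\in W_h$ has exactly the same incoming edges in $G_h$ as in $G$, and let $B_h=V_h\setminus W_h$. Then a set $T\subseteq W_h$ induces an almost top SCC with respect to a vertex $v\in V$ in $G_h$ if and only if it induces an almost top SCC with respect to $v$ in $G$. If moreover $B_h\neq\emptyset$, the same equivalence holds with $G_h$ replaced by $G'_h$.
   Context: A top SCC (tSCC) is a strongly connected component with no incoming edges from outside it. For a graph $H$ and a vertex $v$, a vertex set $T$ induces an almost tSCC with respect to $v$ in $H$ if $H[T]$ is a tSCC of $H\setminus\{v\}$ but $T$ has an incoming edge from $v$ in $H$. The graph $G'_h$ with root $r_h$: if $|B_h|\ge 2$, $G'_h$ is $G_h$ plus a new vertex $r_h$ and an edge from $r_h$ to each vertex of $B_h$; if $|B_h|=1$, $r_h$ is the unique vertex of $B_h$ and $G'_h=G_h$. -}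

module Defs where

open import Data.Product using (Σ; ∃; _×_; _,_)
open import Data.Empty using (⊥)
open import Data.Unit using (⊤)
open import Data.Maybe using (Maybe; just; nothing)
open import Relation.Nullary using (¬_)
open import Relation.Binary.PropositionalEquality using (_≡_; _≢_)
open import Relation.Binary.Construct.Closure.ReflexiveTransitive using (Star)

VSet : Set → Set₁
VSet A = A → Set

_⊆_ : {A : Set} → VSet A → VSet A → Set
S ⊆ T = ∀ {x} → S x → T x

record Graph (A : Set) : Set₁ where
  field
    V : VSet A
    E : A → A → Set
open Graph public

IsDigraph : {A : Set} → Graph A → Set
IsDigraph H = ∀ {x y} → E H x y → V H x × V H y

SubgraphOf : {A : Set} → Graph A → Graph A → Set
SubgraphOf H G = (V H ⊆ V G) × (∀ {x y} → E H x y → E G x y)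

delete : {A : Set} → Graph A → A → Graph A
delete H v = record
  { V = λ x → V H x × x ≢ v
  ; E = λ x y → E H x y × x ≢ v × y ≢ v }

Reach : {A : Set} → Graph A → VSet A → A → A → Set
Reach H T = Star (λ a b → E H a b × T a × T b × V H a × V H b)

StronglyConnected : {A : Set} → Graph A → VSet A → Set
StronglyConnected H T = ∀ {x y} → T x → T y → Reach H T x y

IsSCC : {A : Set} → Graph A → VSet A → Set₁
IsSCC {A} H T =
  (T ⊆ V H) × (∃ T) × StronglyConnected H T ×
  (∀ (T' : VSet A) → T ⊆ T' → T' ⊆ V H → StronglyConnected H T' → T' ⊆ T)

IsTopSCC : {A : Set} → Graph A → VSet A → Set₁
IsTopSCC H T = IsSCC H T × (∀ {x y} → E H x y → T y → T x)

IsAlmostTopSCC : {A : Set} → Graph A → A → VSet A → Set₁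
IsAlmostTopSCC H v T = IsTopSCC (delete H v) T × ∃ (λ y → T y × E H v y)

-- G'_h in the case |B_h| ≥ 2: add a new root r_h = nothing with an edge
-- to each vertex of B_h
addRoot : {A : Set} → Graph A → VSet A → Graph (Maybe A)
addRoot {A} H B = record { V = V' ; E = E' }
  where
  V' : Maybe A → Set
  V' nothing = ⊤
  V' (just x) = V H x
  E' : Maybe A → Maybe A → Set
  E' nothing nothing = ⊥
  E' nothing (just y) = B y
  E' (just x) nothing = ⊥
  E' (just x) (just y) = E H x y

liftSet : {A : Set} → VSet A → VSet (Maybe A)
liftSet T nothing = ⊥
liftSet T (just x) = T x

graphOn : {A : Set} → (A → A → Set) → Graph A
graphOn EG = record { V = λ _ → ⊤ ; E = EG }

blackSet : {A : Set} → Graph A → VSet A → VSet A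
blackSet Gh W x = V Gh x × ¬ W x

module Submission where

open import Defs
open import Data.Nat using (ℕ)
open import Data.Fin using (Fin)
open import Data.Product using (∃; _×_; _,_)
open import Data.Product.Function.NonDependent.Propositional using (_×-⇔_)
open import Data.Unit using (tt)
open import Data.Empty using (⊥-elim)
open import Data.Maybe using (Maybe; just; nothing)
open import Data.Maybe.Properties using (just-injective)
open import Function.Bundles using (_⇔_; mk⇔; Equivalence)
open import Function.Properties.Equivalence using () renaming (refl to ⇔-refl; sym to ⇔-sym; trans to ⇔-trans)
open import Relation.Nullary using (¬_)
open import Relation.Binary.PropositionalEquality using (_≡_; _≢_; cong)
open import Relation.Binary.Construct.Closure.ReflexiveTransitive using (ε; _◅_; gmap)

-- Whether T induces an almost top SCC only depends on the vertices of T and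
-- on the edges entering T: the maximality of a top SCC follows from its
-- closure under in-edges. A white vertex has the same in-edges in G_h as in
-- G, so G_h and G agree on every T ⊆ W_h. The root r_h of G'_h only sends
-- edges to black vertices, hence never into T, so it can be discarded.

private variable
  A : Set

open Equivalence

ClosedUnderInEdges : Graph A → VSet A → Set
ClosedUnderInEdges H T = ∀ {x y} → E H x y → T y → T x

reach-closedUnderInEdges : (H : Graph A) {T T' : VSet A} → ClosedUnderInEdges H T →
  ∀ {x y} → Reach H T' x y → T y → T x
reach-closedUnderInEdges H closed ε ty = ty
reach-closedUnderInEdges H closed ((e , _) ◅ r) ty =
  closed e (reach-closedUnderInEdges H closed r ty)

isTopSCC-intro : (H : Graph A) {T : VSet A} → T ⊆ V H → ∃ T → StronglyConnected H T →
  ClosedUnderInEdges H T → IsTopSCC H T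
isTopSCC-intro H TV (t , tt′) sc closed =
  (TV , (t , tt′) , sc ,
    λ T′ T⊆T′ _ sc′ t′ → reach-closedUnderInEdges H closed (sc′ t′ (T⊆T′ tt′)) tt′)
  , closed

InducedEdge : Graph A → VSet A → A → A → Set
InducedEdge H T a b = E H a b × T a × T b × V H a × V H b

record AgreeOn (H H′ : Graph A) (T : VSet A) : Set where
  field
    vertex : ∀ {x} → T x → V H x ⇔ V H′ x
    inEdge : ∀ {x y} → T y → E H x y ⇔ E H′ x y
open AgreeOn

agreeOn-sym : {H H′ : Graph A} {T : VSet A} → AgreeOn H H′ T → AgreeOn H′ H T
agreeOn-sym agree = record
  { vertex = λ t → ⇔-sym (vertex agree t)
  ; inEdge = λ t → ⇔-sym (inEdge agree t) }

agreeOn-delete : {H H′ : Graph A} {T : VSet A} (v : A) →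
  AgreeOn H H′ T → AgreeOn (delete H v) (delete H′ v) T
agreeOn-delete v agree = record
  { vertex = λ t → vertex agree t ×-⇔ ⇔-refl
  ; inEdge = λ t → inEdge agree t ×-⇔ ⇔-refl }

isTopSCC-transfer : {H H′ : Graph A} {T : VSet A} → AgreeOn H H′ T →
  IsTopSCC H T → IsTopSCC H′ T
isTopSCC-transfer {H = H} {H′} {T} agree ((TV , nonempty , sc , _) , closed) =
  isTopSCC-intro H′ (λ t → to (vertex agree t) (TV t)) nonempty
    (λ tx ty → gmap (λ x → x) step (sc tx ty))
    (λ e ty → closed (from (inEdge agree ty) e) ty)
  where
  step : ∀ {a b} → InducedEdge H T a b → InducedEdge H′ T a b
  step (e , ta , tb , va , vb) =
    to (inEdge agree tb) e , ta , tb , to (vertex agree ta) va , to (vertex agree tb) vb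

isTopSCC-⇔ : {H H′ : Graph A} {T : VSet A} → AgreeOn H H′ T → IsTopSCC H T ⇔ IsTopSCC H′ T
isTopSCC-⇔ agree = mk⇔ (isTopSCC-transfer agree) (isTopSCC-transfer (agreeOn-sym agree))

isAlmostTopSCC-transfer : {H H′ : Graph A} {T : VSet A} {v : A} → AgreeOn H H′ T →
  IsAlmostTopSCC H v T → IsAlmostTopSCC H′ v T
isAlmostTopSCC-transfer {v = v} agree (top , (y , ty , e)) =
  isTopSCC-transfer (agreeOn-delete v agree) top , (y , ty , to (inEdge agree ty) e)

isAlmostTopSCC-⇔ : {H H′ : Graph A} {T : VSet A} {v : A} → AgreeOn H H′ T →
  IsAlmostTopSCC H v T ⇔ IsAlmostTopSCC H′ v T
isAlmostTopSCC-⇔ agree =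
  mk⇔ (isAlmostTopSCC-transfer agree) (isAlmostTopSCC-transfer (agreeOn-sym agree))

restrict : Graph (Maybe A) → Graph A
restrict K = record { V = λ x → V K (just x) ; E = λ x y → E K (just x) (just y) }

just-≢⇔ : {x y : A} → (just x ≢ just y) ⇔ (x ≢ y)
just-≢⇔ = mk⇔ (λ ne eq → ne (cong just eq)) (λ ne eq → ne (just-injective eq))

restrict-delete : (K : Graph (Maybe A)) (v : A) (T : VSet A) →
  AgreeOn (restrict (delete K (just v))) (delete (restrict K) v) T
restrict-delete K v T = record
  { vertex = λ _ → ⇔-refl ×-⇔ just-≢⇔
  ; inEdge = λ _ → ⇔-refl ×-⇔ just-≢⇔ ×-⇔ just-≢⇔ }

NoRootEdgeInto : Graph (Maybe A) → VSet A → Set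
NoRootEdgeInto K T = ∀ {y} → T y → ¬ E K nothing (just y)

module _ (K : Graph (Maybe A)) {T : VSet A} (noRootEdge : NoRootEdgeInto K T) where

  reach-lower : ∀ {a b} → Reach K (liftSet T) (just a) (just b) → Reach (restrict K) T a b
  reach-lower ε = ε
  reach-lower (_◅_ {j = nothing} (_ , _ , () , _) _)
  reach-lower (_◅_ {j = just _} step r) = step ◅ reach-lower r

  isTopSCC-lower : IsTopSCC K (liftSet T) → IsTopSCC (restrict K) T
  isTopSCC-lower ((TV , nonempty , sc , _) , closed) =
    isTopSCC-intro (restrict K) TV (lowerWitness nonempty)
      (λ tx ty → reach-lower (sc tx ty)) closed
    where
    lowerWitness : ∃ (liftSet T) → ∃ T
    lowerWitness (just t , tt′) = t , tt′

  isTopSCC-lift : IsTopSCC (restrict K) T → IsTopSCC K (liftSet T)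
  isTopSCC-lift ((TV , (t , tt′) , sc , _) , closed) =
    isTopSCC-intro K TV′ (just t , tt′) sc′ closed′
    where
    TV′ : liftSet T ⊆ V K
    TV′ {just x} tx = TV tx
    sc′ : StronglyConnected K (liftSet T)
    sc′ {just x} {just y} tx ty = gmap just (λ step → step) (sc tx ty)
    closed′ : ClosedUnderInEdges K (liftSet T)
    closed′ {nothing} {just y} e ty = ⊥-elim (noRootEdge ty e)
    closed′ {just x} {just y} e ty = closed e ty

  isTopSCC-restrict-⇔ : IsTopSCC K (liftSet T) ⇔ IsTopSCC (restrict K) T
  isTopSCC-restrict-⇔ = mk⇔ isTopSCC-lower isTopSCC-lift

isAlmostTopSCC-restrict-⇔ : (K : Graph (Maybe A)) {T : VSet A} {v : A} → NoRootEdgeInto K T →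
  IsAlmostTopSCC K (just v) (liftSet T) ⇔ IsAlmostTopSCC (restrict K) v T
isAlmostTopSCC-restrict-⇔ K {T} {v} noRootEdge =
  ⇔-trans (isTopSCC-restrict-⇔ (delete K (just v)) (λ ty (e , _) → noRootEdge ty e))
          (isTopSCC-⇔ (restrict-delete K v T))
  ×-⇔ mk⇔ (λ { (just y , ty , e) → y , ty , e })
          (λ { (y , ty , e) → just y , ty , e })

module _ {EG : A → A → Set} {Gh : Graph A} {W : VSet A}
  (W⊆V : W ⊆ V Gh)
  (whiteInEdges : ∀ {u} → W u → ∀ x → (E Gh x u ⇔ E (graphOn EG) x u))
  {T : VSet A} (T⊆W : T ⊆ W) where

  agreeOn-white : AgreeOn Gh (graphOn EG) T
  agreeOn-white = record
    { vertex = λ t → mk⇔ (λ _ → tt) (λ _ → W⊆V (T⊆W t))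
    ; inEdge = λ {x} t → whiteInEdges (T⊆W t) x }

  noRootEdgeInto-white : NoRootEdgeInto (addRoot Gh (blackSet Gh W)) T
  noRootEdgeInto-white t (_ , notWhite) = notWhite (T⊆W t)

  isAlmostTopSCC-subgraph-⇔ : {v : A} → IsAlmostTopSCC Gh v T ⇔ IsAlmostTopSCC (graphOn EG) v T
  isAlmostTopSCC-subgraph-⇔ = isAlmostTopSCC-⇔ agreeOn-white

  isAlmostTopSCC-addRoot-⇔ : {v : A} →
    IsAlmostTopSCC (addRoot Gh (blackSet Gh W)) (just v) (liftSet T) ⇔ IsAlmostTopSCC (graphOn EG) v T
  isAlmostTopSCC-addRoot-⇔ =
    ⇔-trans (isAlmostTopSCC-restrict-⇔ (addRoot Gh (blackSet Gh W)) noRootEdgeInto-white)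
            isAlmostTopSCC-subgraph-⇔

mainTheorem6 : (n : ℕ) (EG : Fin n → Fin n → Set) (Gh : Graph (Fin n)) (W : VSet (Fin n)) →
    IsDigraph Gh → SubgraphOf Gh (graphOn EG) → W ⊆ V Gh →
    (∀ {u} → W u → ∀ x → (E Gh x u ⇔ E (graphOn EG) x u)) →
    (∀ (v : Fin n) (T : VSet (Fin n)) → T ⊆ W →
      (IsAlmostTopSCC Gh v T ⇔ IsAlmostTopSCC (graphOn EG) v T))
    × ((∃ λ b₁ → ∃ λ b₂ → blackSet Gh W b₁ × blackSet Gh W b₂ × b₁ ≢ b₂) →
        ∀ (v : Fin n) (T : VSet (Fin n)) → T ⊆ W →
        (IsAlmostTopSCC (addRoot Gh (blackSet Gh W)) (just v) (liftSet T) ⇔ IsAlmostTopSCC (graphOn EG) v T))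
    × ((∃ λ b → blackSet Gh W b × (∀ b' → blackSet Gh W b' → b' ≡ b)) →
        ∀ (v : Fin n) (T : VSet (Fin n)) → T ⊆ W →
        (IsAlmostTopSCC Gh v T ⇔ IsAlmostTopSCC (graphOn EG) v T))
mainTheorem6 n EG Gh W _ _ W⊆V whiteInEdges =
  (λ v T T⊆W → isAlmostTopSCC-subgraph-⇔ W⊆V whiteInEdges T⊆W) ,
  (λ _ v T T⊆W → isAlmostTopSCC-addRoot-⇔ W⊆V whiteInEdges T⊆W) ,
  (λ _ v T T⊆W → isAlmostTopSCC-subgraph-⇔ W⊆V whiteInEdges T⊆W)
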